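{- If $\pi$ is a proof of $F$ (in multiplicative additive linear logic), then $\pi^*$ is a seed in $F^*$.
   Context: An interface $X$ is a pair $(|X|,P_X)$ with $|X|$ a set and $P_X$ a monotonic predicate transformer on $\mathcal{P}(|X|)$; a seed of $X$ is $x\subseteq|X|$ with $x\subseteq P_X(x)$. $\overline{x}$ denotes complement. Dual: $X^\perp=(|X|,x\mapsto\overline{P_X(\overline{x})})$. Tensor: $X\otimes Y=(|X|\times|Y|,\ r\mapsto\bigcup_{x\times y\subseteq r}P_X(x)\times P_Y(y))$. With: $X\& Y=(|X|+|Y|,\ (x,y)\mapsto(P_X(x),P_Y(y)))$. Par: $X\mathbin{\text{⅋}}Y=(X^\perp\otimes Y^\perp)^\perp$; plus: $X\oplus Y=(X^\perp\& Y^\perp)^\perp$; $\mathbf{0}=(\emptyset,\mathrm{Id})$, $\top=\mathbf{0}^\perp$, $\mathbf{1}=(\{*\},\mathrm{Id})$, $\bot=\mathbf{1}^\perp$. A formula $F$ is interpreted by the interface $F^*$ built with these operations, and a sequent $A_1,\dots,A_n$ by $A_1\mathbin{\text{⅋}}\cdots\mathbin{\text{⅋}}A_n$. Proofs are interpreted by subsets of the state space: axiom-free rules: $\vdash\mathbf{1}$ gives $\{*\}$; $\vdash\Gamma,\top$ gives $\emptyset$; from $\pi_1\vdash\Gamma$ to $\vdash\Gamma,\bot$ gives $\{(\gamma,*)\mid\gamma\in\pi_1^*\}$; par rule gives $\{(\gamma,(a,b))\mid(\gamma,a,b)\in\pi_1^*\}$; tensor rule from $\pi_1\vdash\Gamma,A$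 and $\pi_2\vdash\Delta,B$ gives $\{(\gamma,\delta,(a,b))\mid(\gamma,a)\in\pi_1^*,(\delta,b)\in\pi_2^*\}$; the two plus rules give $\{(\gamma,(1,a))\mid(\gamma,a)\in\pi_1^*\}$ and $\{(\gamma,(2,b))\mid(\gamma,b)\in\pi_1^*\}$; with rule gives $\{(\gamma,(1,a))\mid(\gamma,a)\in\pi_1^*\}\cup\{(\gamma,(2,b))\mid(\gamma,b)\in\pi_2^*\}$; cut from $\pi_1\vdash\Gamma,A$ and $\pi_2\vdash\Delta,A^\perp$ gives $\{(\gamma,\delta)\mid\exists a\,(\gamma,a)\in\pi_1^*\wedge(\delta,a)\in\pi_2^*\}$. -}

module Defs where

open import Data.Bool using (Bool; T)
open import Data.Empty renaming (⊥ to Empty)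
open import Data.Unit renaming (⊤ to Unit)
open import Data.Product using (Σ; _×_; _,_; proj₁; proj₂)
open import Data.Sum using (_⊎_; inj₁; inj₂)
open import Function using (id; _∘_)
open import Relation.Nullary using (¬_)
open import Relation.Binary.PropositionalEquality using (_≡_; refl; cong₂; sym; subst)

Pred : Set → Set₁
Pred A = A → Set

_⊆_ : {A : Set} → Pred A → Pred A → Set
x ⊆ y = ∀ a → x a → y a

∁ : {A : Set} → Pred A → Pred A
∁ x = λ a → ¬ x a

record Interface : Set₁ where
  field
    Carrier : Set
    P       : Pred Carrier → Pred Carrier
    mono    : ∀ {x y} → x ⊆ y → P x ⊆ P y
open Interface public

Seed : (X : Interface) → Pred (Carrier X) → Set
Seed X x = x ⊆ P X x

_^⊥ᵢ : Interface → Interface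
X ^⊥ᵢ = record
  { Carrier = Carrier X
  ; P = λ x → ∁ (P X (∁ x))
  ; mono = λ {x} {y} x⊆y a h q → h (mono X (λ b nyb xb → nyb (x⊆y b xb)) a q)
  }

-- tensor: r ↦ ⋃_{x × y ⊆ r} P_X(x) × P_Y(y)
-- (x, y range over all subsets, represented by characteristic functions)
tensorP : (X Y : Interface) → Pred (Carrier X × Carrier Y) → Pred (Carrier X × Carrier Y)
tensorP X Y r (a , b) =
  Σ (Carrier X → Bool) λ x → Σ (Carrier Y → Bool) λ y →
    (∀ a' b' → T (x a') → T (y b') → r (a' , b'))
    × P X (T ∘ x) a × P Y (T ∘ y) b

tensorMono : (X Y : Interface) → ∀ {r s} → r ⊆ s → tensorP X Y r ⊆ tensorP X Y s
tensorMono X Y r⊆s (a , b) (x , y , c , p , q) =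
  x , y , (λ a' b' u v → r⊆s (a' , b') (c a' b' u v)) , p , q

_⊗ᵢ_ : Interface → Interface → Interface
X ⊗ᵢ Y = record
  { Carrier = Carrier X × Carrier Y
  ; P = tensorP X Y
  ; mono = tensorMono X Y
  }

withP : (X Y : Interface) → Pred (Carrier X ⊎ Carrier Y) → Pred (Carrier X ⊎ Carrier Y)
withP X Y z (inj₁ a) = P X (z ∘ inj₁) a
withP X Y z (inj₂ b) = P Y (z ∘ inj₂) b

withMono : (X Y : Interface) → ∀ {r s} → r ⊆ s → withP X Y r ⊆ withP X Y s
withMono X Y r⊆s (inj₁ a) h = mono X (λ a' → r⊆s (inj₁ a')) a h
withMono X Y r⊆s (inj₂ b) h = mono Y (λ b' → r⊆s (inj₂ b')) b h

_&ᵢ_ : Interface → Interface → Interface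
X &ᵢ Y = record
  { Carrier = Carrier X ⊎ Carrier Y
  ; P = withP X Y
  ; mono = withMono X Y
  }

_⅋ᵢ_ : Interface → Interface → Interface
X ⅋ᵢ Y = ((X ^⊥ᵢ) ⊗ᵢ (Y ^⊥ᵢ)) ^⊥ᵢ

_⊕ᵢ_ : Interface → Interface → Interface
X ⊕ᵢ Y = ((X ^⊥ᵢ) &ᵢ (Y ^⊥ᵢ)) ^⊥ᵢ

𝟎ᵢ : Interface
𝟎ᵢ = record { Carrier = Empty ; P = id ; mono = λ h → h }

⊤ᵢ : Interface
⊤ᵢ = 𝟎ᵢ ^⊥ᵢ

𝟏ᵢ : Interface
𝟏ᵢ = record { Carrier = Unit ; P = id ; mono = λ h → h }

⊥ᵢ : Interface
⊥ᵢ = 𝟏ᵢ ^⊥ᵢ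

infixl 7 _⊗_ _&_
infixl 6 _⅋_ _⊕_

data Formula : Set where
  𝟎 ⊤ₗ 𝟏 ⊥ₗ : Formula
  _⊗_ _⅋_ _&_ _⊕_ : Formula → Formula → Formula

_ᗮ : Formula → Formula
𝟎 ᗮ = ⊤ₗ
⊤ₗ ᗮ = 𝟎
𝟏 ᗮ = ⊥ₗ
⊥ₗ ᗮ = 𝟏
(A ⊗ B) ᗮ = (A ᗮ) ⅋ (B ᗮ)
(A ⅋ B) ᗮ = (A ᗮ) ⊗ (B ᗮ)
(A & B) ᗮ = (A ᗮ) ⊕ (B ᗮ)
(A ⊕ B) ᗮ = (A ᗮ) & (B ᗮ)

_* : Formula → Interface
𝟎 * = 𝟎ᵢ
⊤ₗ * = ⊤ᵢ
𝟏 * = 𝟏ᵢ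
⊥ₗ * = ⊥ᵢ
(A ⊗ B) * = (A *) ⊗ᵢ (B *)
(A ⅋ B) * = (A *) ⅋ᵢ (B *)
(A & B) * = (A *) &ᵢ (B *)
(A ⊕ B) * = (A *) ⊕ᵢ (B *)

∣_∣f : Formula → Set
∣ A ∣f = Carrier (A *)

dual-carrier : ∀ A → ∣ A ᗮ ∣f ≡ ∣ A ∣f
dual-carrier 𝟎 = refl
dual-carrier ⊤ₗ = refl
dual-carrier 𝟏 = refl
dual-carrier ⊥ₗ = refl
dual-carrier (A ⊗ B) = cong₂ _×_ (dual-carrier A) (dual-carrier B)
dual-carrier (A ⅋ B) = cong₂ _×_ (dual-carrier A) (dual-carrier B)
dual-carrier (A & B) = cong₂ _⊎_ (dual-carrier A) (dual-carrier B)
dual-carrier (A ⊕ B) = cong₂ _⊎_ (dual-carrier A) (dual-carrier B)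

castᗮ : ∀ A → ∣ A ∣f → ∣ A ᗮ ∣f
castᗮ A a = subst id (sym (dual-carrier A)) a

infixl 5 _▸_
data Seq : Set where
  []  : Seq
  _▸_ : Seq → Formula → Seq

infixl 4 _++_
_++_ : Seq → Seq → Seq
Γ ++ [] = Γ
Γ ++ (Δ ▸ A) = (Γ ++ Δ) ▸ A

snocI : Seq → Formula → Interface
snocI [] A = A *
snocI (Γ ▸ B) A = snocI Γ B ⅋ᵢ (A *)

-- interpretation of a sequent; the empty sequent is ⊥ (unit of ⅋)
SeqI : Seq → Interface
SeqI [] = ⊥ᵢ
SeqI (Γ ▸ A) = snocI Γ A

∣_∣s : Seq → Set
∣ Γ ∣s = Carrier (SeqI Γ)

snoc : ∀ Γ A → ∣ Γ ∣s → ∣ A ∣f → ∣ Γ ▸ A ∣s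
snoc [] A g a = a
snoc (Γ ▸ B) A g a = g , a

unsnoc : ∀ Γ A → ∣ Γ ▸ A ∣s → ∣ Γ ∣s × ∣ A ∣f
unsnoc [] A a = tt , a
unsnoc (Γ ▸ B) A p = p

join : ∀ Γ Δ → ∣ Γ ∣s → ∣ Δ ∣s → ∣ Γ ++ Δ ∣s
join Γ [] g d = g
join Γ (Δ ▸ A) g d =
  snoc (Γ ++ Δ) A (join Γ Δ g (proj₁ (unsnoc Δ A d))) (proj₂ (unsnoc Δ A d))

split : ∀ Γ Δ → ∣ Γ ++ Δ ∣s → ∣ Γ ∣s × ∣ Δ ∣s
split Γ [] s = s , tt
split Γ (Δ ▸ A) s =
  proj₁ (split Γ Δ (proj₁ (unsnoc (Γ ++ Δ) A s))) ,
  snoc Δ A (proj₂ (split Γ Δ (proj₁ (unsnoc (Γ ++ Δ) A s)))) (proj₂ (unsnoc (Γ ++ Δ) A s))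

infix 3 ⊢_
data ⊢_ : Seq → Set where
  one  : ⊢ [] ▸ 𝟏
  top  : ∀ {Γ} → ⊢ Γ ▸ ⊤ₗ
  bot  : ∀ {Γ} → ⊢ Γ → ⊢ Γ ▸ ⊥ₗ
  par  : ∀ {Γ A B} → ⊢ Γ ▸ A ▸ B → ⊢ Γ ▸ A ⅋ B
  tens : ∀ {Γ Δ A B} → ⊢ Γ ▸ A → ⊢ Δ ▸ B → ⊢ (Γ ++ Δ) ▸ A ⊗ B
  plus₁ : ∀ {Γ A B} → ⊢ Γ ▸ A → ⊢ Γ ▸ A ⊕ B
  plus₂ : ∀ {Γ A B} → ⊢ Γ ▸ B → ⊢ Γ ▸ A ⊕ B
  with' : ∀ {Γ A B} → ⊢ Γ ▸ A → ⊢ Γ ▸ B → ⊢ Γ ▸ A & B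
  cut  : ∀ {Γ Δ A} → ⊢ Γ ▸ A → ⊢ Δ ▸ A ᗮ → ⊢ Γ ++ Δ
  exch : ∀ {Γ A B} Δ → ⊢ (Γ ▸ A ▸ B) ++ Δ → ⊢ (Γ ▸ B ▸ A) ++ Δ

⟦_⟧ : ∀ {Γ} → ⊢ Γ → Pred ∣ Γ ∣s
⟦ one ⟧ s = Unit
⟦ top ⟧ s = Empty
⟦ bot {Γ} π ⟧ s = ⟦ π ⟧ (proj₁ (unsnoc Γ ⊥ₗ s))
⟦ par {Γ} {A} {B} π ⟧ s =
  ⟦ π ⟧ (snoc (Γ ▸ A) B (snoc Γ A (proj₁ (unsnoc Γ (A ⅋ B) s))
                                   (proj₁ (proj₂ (unsnoc Γ (A ⅋ B) s))))
                         (proj₂ (proj₂ (unsnoc Γ (A ⅋ B) s))))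
⟦ tens {Γ} {Δ} {A} {B} π₁ π₂ ⟧ s =
  ⟦ π₁ ⟧ (snoc Γ A (proj₁ (split Γ Δ (proj₁ (unsnoc (Γ ++ Δ) (A ⊗ B) s))))
                   (proj₁ (proj₂ (unsnoc (Γ ++ Δ) (A ⊗ B) s))))
  × ⟦ π₂ ⟧ (snoc Δ B (proj₂ (split Γ Δ (proj₁ (unsnoc (Γ ++ Δ) (A ⊗ B) s))))
                     (proj₂ (proj₂ (unsnoc (Γ ++ Δ) (A ⊗ B) s))))
⟦ plus₁ {Γ} {A} {B} π ⟧ s = plusCase (unsnoc Γ (A ⊕ B) s)
  where
  plusCase : ∣ Γ ∣s × (∣ A ∣f ⊎ ∣ B ∣f) → Set
  plusCase (g , inj₁ a) = ⟦ π ⟧ (snoc Γ A g a)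
  plusCase (g , inj₂ b) = Empty
⟦ plus₂ {Γ} {A} {B} π ⟧ s = plusCase (unsnoc Γ (A ⊕ B) s)
  where
  plusCase : ∣ Γ ∣s × (∣ A ∣f ⊎ ∣ B ∣f) → Set
  plusCase (g , inj₁ a) = Empty
  plusCase (g , inj₂ b) = ⟦ π ⟧ (snoc Γ B g b)
⟦ with' {Γ} {A} {B} π₁ π₂ ⟧ s = withCase (unsnoc Γ (A & B) s)
  where
  withCase : ∣ Γ ∣s × (∣ A ∣f ⊎ ∣ B ∣f) → Set
  withCase (g , inj₁ a) = ⟦ π₁ ⟧ (snoc Γ A g a)
  withCase (g , inj₂ b) = ⟦ π₂ ⟧ (snoc Γ B g b)
⟦ cut {Γ} {Δ} {A} π₁ π₂ ⟧ s =
  Σ ∣ A ∣f λ a → ⟦ π₁ ⟧ (snoc Γ A (proj₁ (split Γ Δ s)) a)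
               × ⟦ π₂ ⟧ (snoc Δ (A ᗮ) (proj₂ (split Γ Δ s)) (castᗮ A a))
⟦ exch {Γ} {A} {B} Δ π ⟧ s =
  ⟦ π ⟧ (join (Γ ▸ A ▸ B) Δ
          (snoc (Γ ▸ A) B (snoc Γ A γ a) b)
          (proj₂ (split (Γ ▸ B ▸ A) Δ s)))
  where
  gba = proj₁ (split (Γ ▸ B ▸ A) Δ s)
  a = proj₂ (unsnoc (Γ ▸ B) A gba)
  γ = proj₁ (unsnoc Γ B (proj₁ (unsnoc (Γ ▸ B) A gba)))
  b = proj₂ (unsnoc Γ B (proj₁ (unsnoc (Γ ▸ B) A gba)))

module Submission where

-- All carriers are finite and every P maps decidable subsets to decidable subsets, so proof
-- sets are decidable and double negations can be removed where needed. The theorem is proved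
-- for every sequent Γ = A₁, …, Aₙ in the form SeqSeed: if a box u₁ × ⋯ × uₙ misses π*, then no
-- state of π* lies in the dual box P_{A₁}^⊥(u₁) × ⋯ × P_{Aₙ}^⊥(uₙ). Each rule preserves this.
-- For ⊗ and cut, testing the premiss Γ, A against the box U × ∁s, where s is the shadow
-- {a | (γ, a) ∈ π* for some γ ∈ U}, puts a into P_A(s); the two shadows then witness the
-- tensor, respectively are disjoint, which contradicts (Aᗮ)* ⊆ (A*)^⊥. For a single formula F,
-- the box ∁π* turns SeqSeed into π* ⊆ P_F(π*).

open import Defs
open import Data.Bool using (Bool; T)
open import Data.Empty renaming (⊥ to Empty)
open import Data.Unit renaming (⊤ to Unit) using (tt)
open import Data.Nat using (_+_; _*_)
open import Data.Fin using (Fin)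
open import Data.Fin.Properties using (0↔⊥; 1↔⊤; +↔⊎; *↔×; any?; all?)
open import Data.Fin.Subset using (Subset)
open import Data.Fin.Subset.Properties using (anySubset?)
open import Data.Vec using (lookup; tabulate)
open import Data.Vec.Properties using (lookup∘tabulate)
open import Data.Product using (Σ; ∃; ∃-syntax; _×_; _,_; proj₁; proj₂; uncurry)
open import Data.Product.Function.NonDependent.Propositional using (_×-↔_)
open import Data.Sum using (_⊎_; inj₁; inj₂)
open import Data.Sum.Function.Propositional using (_⊎-↔_)
open import Function using (id; _∘_)
open import Function.Bundles using (_↔_; Inverse)
open import Function.Properties.Inverse using (↔-sym; ↔-trans)
open import Relation.Nullary using (¬_; Dec; yes; no)
open import Relation.Nullary.Decidable using (map′; ¬?; _×-dec_; _→-dec_; T?; decidable-stable; isYes; toWitness; fromWitness)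
open import Relation.Unary using (Decidable; _≬_)
open import Relation.Binary.PropositionalEquality using (_≡_; _≗_; refl; sym; trans; cong; cong₂; subst)
open import Relation.Binary.PropositionalEquality.Properties using (subst-sym-subst; subst-subst-sym)

Finite : Set → Set
Finite X = ∃[ n ] (X ↔ Fin n)

finite-⊥ : Finite Empty
finite-⊥ = 0 , ↔-sym 0↔⊥

finite-⊤ : Finite Unit
finite-⊤ = 1 , ↔-sym 1↔⊤

finite-× : {X Y : Set} → Finite X → Finite Y → Finite (X × Y)
finite-× (m , e) (n , f) = m * n , ↔-trans (e ×-↔ f) (↔-sym *↔×)

finite-⊎ : {X Y : Set} → Finite X → Finite Y → Finite (X ⊎ Y)
finite-⊎ (m , e) (n , f) = m + n , ↔-trans (e ⊎-↔ f) (↔-sym +↔⊎)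

module _ {X : Set} (fin : Finite X) where
  open Inverse (proj₂ fin)

  ∃? : {Q : X → Set} → Decidable Q → Dec (∃ Q)
  ∃? {Q} Q? = map′ (λ (i , q) → from i , q)
                   (λ (x , q) → to x , subst Q (sym (strictlyInverseʳ x)) q)
                   (any? (Q? ∘ from))

  ∀? : {Q : X → Set} → Decidable Q → Dec (∀ x → Q x)
  ∀? {Q} Q? = map′ (λ h x → subst Q (strictlyInverseʳ x) (h (to x)))
                   (λ h i → h (from i))
                   (all? (Q? ∘ from))

  ∃-fun? : {Q : (X → Bool) → Set} → (∀ {u v} → u ≗ v → Q u → Q v) →
           Decidable Q → Dec (∃ Q)
  ∃-fun? {Q} resp Q? = map′ (λ (s , q) → fromSubset s , q)
                            (λ (u , q) → tabulate (u ∘ from) , resp (round-trip u) q)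
                            (anySubset? (Q? ∘ fromSubset))
    where
    fromSubset : Subset (proj₁ fin) → X → Bool
    fromSubset s x = lookup s (to x)
    round-trip : (u : X → Bool) → u ≗ fromSubset (tabulate (u ∘ from))
    round-trip u x = sym (trans (lookup∘tabulate (u ∘ from) (to x)) (cong u (strictlyInverseʳ x)))

≗⇒⊆ : {X : Set} {u v : X → Bool} → u ≗ v → (T ∘ u) ⊆ (T ∘ v)
≗⇒⊆ u≗v a = subst T (u≗v a)

record DecidableInterface (X : Interface) : Set₁ where
  field
    finite : Finite (Carrier X)
    P?     : ∀ {x} → Decidable x → Decidable (P X x)
open DecidableInterface

dec-𝟎 : DecidableInterface 𝟎ᵢ
dec-𝟎 = record { finite = finite-⊥ ; P? = id }

dec-𝟏 : DecidableInterface 𝟏ᵢ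
dec-𝟏 = record { finite = finite-⊤ ; P? = id }

dec-^⊥ : ∀ {X} → DecidableInterface X → DecidableInterface (X ^⊥ᵢ)
dec-^⊥ D = record { finite = finite D ; P? = λ x? a → ¬? (P? D (¬? ∘ x?) a) }

dec-& : ∀ {X Y} → DecidableInterface X → DecidableInterface Y → DecidableInterface (X &ᵢ Y)
dec-& {X} {Y} DX DY = record { finite = finite-⊎ (finite DX) (finite DY) ; P? = with? }
  where
  with? : ∀ {z} → Decidable z → Decidable (withP X Y z)
  with? z? (inj₁ a) = P? DX (z? ∘ inj₁) a
  with? z? (inj₂ b) = P? DY (z? ∘ inj₂) b

dec-⊗ : ∀ {X Y} → DecidableInterface X → DecidableInterface Y → DecidableInterface (X ⊗ᵢ Y)
dec-⊗ {X} {Y} DX DY = record { finite = finite-× (finite DX) (finite DY) ; P? = tensor? }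
  where
  module _ {r : Pred (Carrier X × Carrier Y)} (r? : Decidable r)
           (a : Carrier X) (b : Carrier Y) where
    Witness : (Carrier X → Bool) → (Carrier Y → Bool) → Set
    Witness x y = (∀ a′ b′ → T (x a′) → T (y b′) → r (a′ , b′)) × P X (T ∘ x) a × P Y (T ∘ y) b

    witness? : ∀ x y → Dec (Witness x y)
    witness? x y =
      ∀? (finite DX) (λ a′ → ∀? (finite DY) (λ b′ → T? (x a′) →-dec T? (y b′) →-dec r? (a′ , b′)))
      ×-dec P? DX (T? ∘ x) a ×-dec P? DY (T? ∘ y) b

    resp-x : ∀ {x x′} → x ≗ x′ → ∃ (Witness x) → ∃ (Witness x′)
    resp-x x≗x′ (y , c , p , q) =
      y , (λ a′ b′ → c a′ b′ ∘ ≗⇒⊆ (sym ∘ x≗x′) a′) , mono X (≗⇒⊆ x≗x′) a p , q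

    resp-y : ∀ x {y y′} → y ≗ y′ → Witness x y → Witness x y′
    resp-y x y≗y′ (c , p , q) =
      (λ a′ b′ t → c a′ b′ t ∘ ≗⇒⊆ (sym ∘ y≗y′) b′) , p , mono Y (≗⇒⊆ y≗y′) b q

  tensor? : ∀ {r} → Decidable r → Decidable (tensorP X Y r)
  tensor? r? (a , b) =
    ∃-fun? (finite DX) (resp-x r? a b)
      (λ x → ∃-fun? (finite DY) (resp-y r? a b x) (witness? r? a b x))

dec-⅋ : ∀ {X Y} → DecidableInterface X → DecidableInterface Y → DecidableInterface (X ⅋ᵢ Y)
dec-⅋ DX DY = dec-^⊥ (dec-⊗ (dec-^⊥ DX) (dec-^⊥ DY))

dec-⊕ : ∀ {X Y} → DecidableInterface X → DecidableInterface Y → DecidableInterface (X ⊕ᵢ Y)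
dec-⊕ DX DY = dec-^⊥ (dec-& (dec-^⊥ DX) (dec-^⊥ DY))

decidable-* : ∀ F → DecidableInterface (F *)
decidable-* 𝟎 = dec-𝟎
decidable-* ⊤ₗ = dec-^⊥ dec-𝟎
decidable-* 𝟏 = dec-𝟏
decidable-* ⊥ₗ = dec-^⊥ dec-𝟏
decidable-* (A ⊗ B) = dec-⊗ (decidable-* A) (decidable-* B)
decidable-* (A ⅋ B) = dec-⅋ (decidable-* A) (decidable-* B)
decidable-* (A & B) = dec-& (decidable-* A) (decidable-* B)
decidable-* (A ⊕ B) = dec-⊕ (decidable-* A) (decidable-* B)

decidable-SeqI : ∀ Γ → DecidableInterface (SeqI Γ)
decidable-SeqI [] = dec-^⊥ dec-𝟏
decidable-SeqI ([] ▸ A) = decidable-* A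
decidable-SeqI (Γ ▸ B ▸ A) = dec-⅋ (decidable-SeqI (Γ ▸ B)) (decidable-* A)

⊕-dual-inj₁ : ∀ X Y {u} a → P ((X ⊕ᵢ Y) ^⊥ᵢ) u (inj₁ a) → P (X ^⊥ᵢ) (u ∘ inj₁) a
⊕-dual-inj₁ X Y a d p = d λ k → k (mono X (λ a′ ¬u ¬¬u → ¬¬u ¬u) a p)

⊕-dual-inj₂ : ∀ X Y {u} b → P ((X ⊕ᵢ Y) ^⊥ᵢ) u (inj₂ b) → P (Y ^⊥ᵢ) (u ∘ inj₂) b
⊕-dual-inj₂ X Y b d p = d λ k → k (mono Y (λ b′ ¬u ¬¬u → ¬¬u ¬u) b p)

subst-× : ∀ {X X′ Y Y′ : Set} (p : X ≡ X′) (q : Y ≡ Y′) a b →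
          subst id (sym (cong₂ _×_ p q)) (a , b) ≡ (subst id (sym p) a , subst id (sym q) b)
subst-× refl refl a b = refl

subst-inj₁ : ∀ {X X′ Y Y′ : Set} (p : X ≡ X′) (q : Y ≡ Y′) a →
             subst id (sym (cong₂ _⊎_ p q)) (inj₁ a) ≡ inj₁ (subst id (sym p) a)
subst-inj₁ refl refl a = refl

subst-inj₂ : ∀ {X X′ Y Y′ : Set} (p : X ≡ X′) (q : Y ≡ Y′) b →
             subst id (sym (cong₂ _⊎_ p q)) (inj₂ b) ≡ inj₂ (subst id (sym q) b)
subst-inj₂ refl refl b = refl

castᗮ-⊗ : ∀ A B a b → castᗮ (A ⊗ B) (a , b) ≡ (castᗮ A a , castᗮ B b)
castᗮ-⊗ A B = subst-× (dual-carrier A) (dual-carrier B)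

castᗮ-⅋ : ∀ A B a b → castᗮ (A ⅋ B) (a , b) ≡ (castᗮ A a , castᗮ B b)
castᗮ-⅋ A B = subst-× (dual-carrier A) (dual-carrier B)

castᗮ-&₁ : ∀ A B a → castᗮ (A & B) (inj₁ a) ≡ inj₁ (castᗮ A a)
castᗮ-&₁ A B = subst-inj₁ (dual-carrier A) (dual-carrier B)

castᗮ-&₂ : ∀ A B b → castᗮ (A & B) (inj₂ b) ≡ inj₂ (castᗮ B b)
castᗮ-&₂ A B = subst-inj₂ (dual-carrier A) (dual-carrier B)

castᗮ-⊕₁ : ∀ A B a → castᗮ (A ⊕ B) (inj₁ a) ≡ inj₁ (castᗮ A a)
castᗮ-⊕₁ A B = subst-inj₁ (dual-carrier A) (dual-carrier B)

castᗮ-⊕₂ : ∀ A B b → castᗮ (A ⊕ B) (inj₂ b) ≡ inj₂ (castᗮ B b)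
castᗮ-⊕₂ A B = subst-inj₂ (dual-carrier A) (dual-carrier B)

uncastᗮ : ∀ A → ∣ A ᗮ ∣f → ∣ A ∣f
uncastᗮ A = subst id (dual-carrier A)

castᗮ-uncastᗮ : ∀ A e → castᗮ A (uncastᗮ A e) ≡ e
castᗮ-uncastᗮ A e = subst-sym-subst (dual-carrier A)

uncastᗮ-castᗮ : ∀ A a → uncastᗮ A (castᗮ A a) ≡ a
uncastᗮ-castᗮ A a = subst-subst-sym (dual-carrier A)

-- Classically an equality; cut needs only this inclusion.
ᗮ*⊆*^⊥ : ∀ A {y : Pred ∣ A ᗮ ∣f} a → P ((A ᗮ) *) y (castᗮ A a) → P ((A *) ^⊥ᵢ) (y ∘ castᗮ A) a
*⊆ᗮ*^⊥ : ∀ A {x : Pred ∣ A ∣f} a → P (A *) x a → P (((A ᗮ) *) ^⊥ᵢ) (x ∘ uncastᗮ A) (castᗮ A a)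

*⊆ᗮ*^⊥ A {x} a p p′ =
  ᗮ*⊆*^⊥ A a p′ (mono (A *) (λ a′ xa′ ¬xa′ → ¬xa′ (subst x (sym (uncastᗮ-castᗮ A a′)) xa′)) a p)

ᗮ*⊆*^⊥ 𝟎 () h
ᗮ*⊆*^⊥ ⊤ₗ () h
ᗮ*⊆*^⊥ 𝟏 a h = h
ᗮ*⊆*^⊥ ⊥ₗ a h k = k λ ¬y → ¬y h
ᗮ*⊆*^⊥ (A ⊗ B) {y} (a , b) h (u , v , u×v⊆¬y , p , q) =
  subst (P (((A ⊗ B) ᗮ) *) y) (castᗮ-⊗ A B a b) h
    (u ∘ uncastᗮ A , v ∘ uncastᗮ B , u×v⊆¬y′ , *⊆ᗮ*^⊥ A a p , *⊆ᗮ*^⊥ B b q)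
  where
  u×v⊆¬y′ : ∀ e e′ → T (u (uncastᗮ A e)) → T (v (uncastᗮ B e′)) → ¬ y (e , e′)
  u×v⊆¬y′ e e′ ue ve′ =
    u×v⊆¬y (uncastᗮ A e) (uncastᗮ B e′) ue ve′ ∘
    subst y (sym (trans (castᗮ-⊗ A B (uncastᗮ A e) (uncastᗮ B e′))
                        (cong₂ _,_ (castᗮ-uncastᗮ A e) (castᗮ-uncastᗮ B e′))))
ᗮ*⊆*^⊥ (A ⅋ B) {y} (a , b) h k with subst (P (((A ⅋ B) ᗮ) *) y) (castᗮ-⅋ A B a b) h
... | u , v , u×v⊆y , p , q =
  k (u ∘ castᗮ A , v ∘ castᗮ B ,
     (λ a′ b′ ua′ vb′ ¬y → ¬y (subst y (sym (castᗮ-⅋ A B a′ b′)) (u×v⊆y _ _ ua′ vb′))) ,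
     ᗮ*⊆*^⊥ A a p , ᗮ*⊆*^⊥ B b q)
ᗮ*⊆*^⊥ (A & B) {y} (inj₁ a) h pa =
  subst (P (((A & B) ᗮ) *) y) (castᗮ-&₁ A B a) h λ pA →
    ᗮ*⊆*^⊥ A a pA (mono (A *) (λ a′ ¬y ¬¬y → ¬¬y (¬y ∘ subst y (sym (castᗮ-&₁ A B a′)))) a pa)
ᗮ*⊆*^⊥ (A & B) {y} (inj₂ b) h pb =
  subst (P (((A & B) ᗮ) *) y) (castᗮ-&₂ A B b) h λ pB →
    ᗮ*⊆*^⊥ B b pB (mono (B *) (λ b′ ¬y ¬¬y → ¬¬y (¬y ∘ subst y (sym (castᗮ-&₂ A B b′)))) b pb)
ᗮ*⊆*^⊥ (A ⊕ B) {y} (inj₁ a) h ¬¬q = ¬¬q λ q →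
  ᗮ*⊆*^⊥ A a (subst (P (((A ⊕ B) ᗮ) *) y) (castᗮ-⊕₁ A B a) h)
    (mono (A *) (λ a′ ¬¬¬y y′ → ¬¬¬y λ ¬y → ¬y (subst y (sym (castᗮ-⊕₁ A B a′)) y′)) a q)
ᗮ*⊆*^⊥ (A ⊕ B) {y} (inj₂ b) h ¬¬q = ¬¬q λ q →
  ᗮ*⊆*^⊥ B b (subst (P (((A ⊕ B) ᗮ) *) y) (castᗮ-⊕₂ A B b) h)
    (mono (B *) (λ b′ ¬¬¬y y′ → ¬¬¬y λ ¬y → ¬y (subst y (sym (castᗮ-⊕₂ A B b′)) y′)) b q)

⟦_⟧? : ∀ {Γ} (π : ⊢ Γ) → Decidable ⟦ π ⟧
⟦ one ⟧? s = yes tt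
⟦ top ⟧? s = no λ ()
⟦ bot π ⟧? s = ⟦ π ⟧? _
⟦ par π ⟧? s = ⟦ π ⟧? _
⟦ tens π₁ π₂ ⟧? s = ⟦ π₁ ⟧? _ ×-dec ⟦ π₂ ⟧? _
⟦ plus₁ {Γ} {A} {B} π ⟧? s with unsnoc Γ (A ⊕ B) s
... | g , inj₁ a = ⟦ π ⟧? _
... | g , inj₂ b = no λ ()
⟦ plus₂ {Γ} {A} {B} π ⟧? s with unsnoc Γ (A ⊕ B) s
... | g , inj₁ a = no λ ()
... | g , inj₂ b = ⟦ π ⟧? _
⟦ with' {Γ} {A} {B} π₁ π₂ ⟧? s with unsnoc Γ (A & B) s
... | g , inj₁ a = ⟦ π₁ ⟧? _
... | g , inj₂ b = ⟦ π₂ ⟧? _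
⟦ cut {A = A} π₁ π₂ ⟧? s = ∃? (finite (decidable-* A)) (λ a → ⟦ π₁ ⟧? _ ×-dec ⟦ π₂ ⟧? _)
⟦ exch Δ π ⟧? s = ⟦ π ⟧? _

unsnoc-snoc : ∀ Γ A g a → unsnoc Γ A (snoc Γ A g a) ≡ (g , a)
unsnoc-snoc [] A g a = refl
unsnoc-snoc (Γ ▸ B) A g a = refl

snoc-unsnoc : ∀ Γ A s → snoc Γ A (proj₁ (unsnoc Γ A s)) (proj₂ (unsnoc Γ A s)) ≡ s
snoc-unsnoc [] A s = refl
snoc-unsnoc (Γ ▸ B) A s = refl

snoc-elim : ∀ Γ A {R : Pred ∣ Γ ▸ A ∣s} → (∀ g a → R (snoc Γ A g a)) → ∀ s → R s
snoc-elim [] A h s = h tt s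
snoc-elim (Γ ▸ B) A h (g , a) = h g a

split-join : ∀ Γ Δ g d → split Γ Δ (join Γ Δ g d) ≡ (g , d)
split-join Γ [] g d = refl
split-join Γ (Δ ▸ A) g d
  rewrite unsnoc-snoc (Γ ++ Δ) A (join Γ Δ g (proj₁ (unsnoc Δ A d))) (proj₂ (unsnoc Δ A d))
        | split-join Γ Δ g (proj₁ (unsnoc Δ A d))
        | snoc-unsnoc Δ A d = refl

join-split : ∀ Γ Δ s → join Γ Δ (proj₁ (split Γ Δ s)) (proj₂ (split Γ Δ s)) ≡ s
join-split Γ [] s = refl
join-split Γ (Δ ▸ A) s
  rewrite unsnoc-snoc Δ A (proj₂ (split Γ Δ (proj₁ (unsnoc (Γ ++ Δ) A s))))
                          (proj₂ (unsnoc (Γ ++ Δ) A s))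
        | join-split Γ Δ (proj₁ (unsnoc (Γ ++ Δ) A s))
        | snoc-unsnoc (Γ ++ Δ) A s = refl

unsnoc-snoc⁺ : ∀ Γ A {Q : Pred (∣ Γ ∣s × ∣ A ∣f)} {g a} → Q (g , a) → Q (unsnoc Γ A (snoc Γ A g a))
unsnoc-snoc⁺ [] A q = q
unsnoc-snoc⁺ (Γ ▸ B) A q = q

Family : Seq → Set
Family [] = Unit
Family (Γ ▸ A) = Family Γ × (∣ A ∣f → Bool)

splitᶠ : ∀ Γ Δ → Family (Γ ++ Δ) → Family Γ × Family Δ
splitᶠ Γ [] U = U , tt
splitᶠ Γ (Δ ▸ A) (U , u) = proj₁ (splitᶠ Γ Δ U) , (proj₂ (splitᶠ Γ Δ U) , u)

joinᶠ : ∀ Γ Δ → Family Γ → Family Δ → Family (Γ ++ Δ)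
joinᶠ Γ [] V W = V
joinᶠ Γ (Δ ▸ A) V (W , w) = joinᶠ Γ Δ V W , w

splitᶠ-joinᶠ : ∀ Γ Δ V W → splitᶠ Γ Δ (joinᶠ Γ Δ V W) ≡ (V , W)
splitᶠ-joinᶠ Γ [] V W = refl
splitᶠ-joinᶠ Γ (Δ ▸ A) V (W , w) rewrite splitᶠ-joinᶠ Γ Δ V W = refl

FormulaRel : Set₁
FormulaRel = (A : Formula) → (∣ A ∣f → Bool) → Pred ∣ A ∣f

Pointwise : FormulaRel → ∀ Γ → Family Γ → Pred ∣ Γ ∣s
Pointwise R [] U s = Unit
Pointwise R (Γ ▸ A) (U , u) s =
  Pointwise R Γ U (proj₁ (unsnoc Γ A s)) × R A u (proj₂ (unsnoc Γ A s))

module _ (R : FormulaRel) where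

  Pointwise-snoc⁺ : ∀ Γ A {U u g a} → Pointwise R Γ U g → R A u a →
                    Pointwise R (Γ ▸ A) (U , u) (snoc Γ A g a)
  Pointwise-snoc⁺ [] A p q = tt , q
  Pointwise-snoc⁺ (Γ ▸ B) A p q = p , q

  Pointwise-snoc⁻ : ∀ Γ A {U u g a} → Pointwise R (Γ ▸ A) (U , u) (snoc Γ A g a) →
                    Pointwise R Γ U g × R A u a
  Pointwise-snoc⁻ [] A (_ , q) = tt , q
  Pointwise-snoc⁻ (Γ ▸ B) A pq = pq

  Pointwise-snoc-¬≬ : ∀ Γ A {U u} {r : Pred ∣ Γ ▸ A ∣s} →
                      (∀ g a → Pointwise R Γ U g → R A u a → ¬ r (snoc Γ A g a)) →
                      ¬ (Pointwise R (Γ ▸ A) (U , u) ≬ r)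
  Pointwise-snoc-¬≬ Γ A {U} {u} {r} h (s , p , rs) =
    snoc-elim Γ A {λ s → Pointwise R (Γ ▸ A) (U , u) s → ¬ r s}
      (λ g a p → uncurry (h g a) (Pointwise-snoc⁻ Γ A {U} {u} p)) s p rs

  Pointwise-split : ∀ Γ Δ {W s} → Pointwise R (Γ ++ Δ) W s →
                    Pointwise R Γ (proj₁ (splitᶠ Γ Δ W)) (proj₁ (split Γ Δ s)) ×
                    Pointwise R Δ (proj₂ (splitᶠ Γ Δ W)) (proj₂ (split Γ Δ s))
  Pointwise-split Γ [] p = p , tt
  Pointwise-split Γ (Δ ▸ A) (p , q) =
    proj₁ (Pointwise-split Γ Δ p) , Pointwise-snoc⁺ Δ A (proj₂ (Pointwise-split Γ Δ p)) q

  Pointwise-join : ∀ Γ Δ {W g d} → Pointwise R Γ (proj₁ (splitᶠ Γ Δ W)) g →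
                   Pointwise R Δ (proj₂ (splitᶠ Γ Δ W)) d → Pointwise R (Γ ++ Δ) W (join Γ Δ g d)
  Pointwise-join Γ [] p q = p
  Pointwise-join Γ (Δ ▸ A) p (q , q′) = Pointwise-snoc⁺ (Γ ++ Δ) A (Pointwise-join Γ Δ p q) q′

complement : {X : Set} {x : Pred X} → Decidable x → X → Bool
complement x? a = isYes (¬? (x? a))

module _ {X : Set} {x : Pred X} (x? : Decidable x) where

  complement-out : ∀ a → T (complement x? a) → ¬ x a
  complement-out a = toWitness

  complement-in : ∀ a → ¬ T (complement x? a) → x a
  complement-in a ∉c = decidable-stable (x? a) (∉c ∘ fromWitness)

Box : ∀ Γ → Family Γ → Pred ∣ Γ ∣s
Box = Pointwise (λ A u → T ∘ u)

DualBox : ∀ Γ → Family Γ → Pred ∣ Γ ∣s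
DualBox = Pointwise (λ A u → P ((A *) ^⊥ᵢ) (T ∘ u))

Box? : ∀ Γ U → Decidable (Box Γ U)
Box? [] U s = yes tt
Box? (Γ ▸ A) (U , u) s = Box? Γ U _ ×-dec T? _

-- Constructive form of r ⊆ P(r) for the interface A₁ ⅋ ⋯ ⅋ Aₙ, whose P(r) is the complement
-- of the union of the products ∏ P_{Aᵢ}^⊥(uᵢ) over the boxes ∏ uᵢ disjoint from r.
SeqSeed : ∀ Γ → Pred ∣ Γ ∣s → Set
SeqSeed Γ r = ∀ U → ¬ (Box Γ U ≬ r) → ¬ (DualBox Γ U ≬ r)

module _ {Γ A} {r : Pred ∣ Γ ▸ A ∣s} (r? : Decidable r) (U : Family Γ) where

  Shadow : Pred ∣ A ∣f
  Shadow a = ∃ λ g → Box Γ U g × r (snoc Γ A g a)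

  Shadow? : Decidable Shadow
  Shadow? a = ∃? (finite (decidable-SeqI Γ)) (λ g → Box? Γ U g ×-dec r? (snoc Γ A g a))

  shadow-P : SeqSeed (Γ ▸ A) r → ∀ {g a} → DualBox Γ U g → r (snoc Γ A g a) → P (A *) Shadow a
  shadow-P seed {g} {a} dg ra =
    decidable-stable (P? (decidable-* A) Shadow? a) λ ¬p →
      seed (U , complement Shadow?) disjoint
        (snoc Γ A g a ,
         Pointwise-snoc⁺ _ Γ A {U} {complement Shadow?} dg
           (¬p ∘ mono (A *) (complement-in Shadow?) a) ,
         ra)
    where
    disjoint : ¬ (Box (Γ ▸ A) (U , complement Shadow?) ≬ r)
    disjoint = Pointwise-snoc-¬≬ _ Γ A {U} {complement Shadow?} λ g a bg ∉shadow rt →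
      complement-out Shadow? a ∉shadow (g , bg , rt)

one-seed : SeqSeed ([] ▸ 𝟏) ⟦ one ⟧
one-seed (tt , u) disjoint (s , (tt , ¬¬u) , _) = ¬¬u (λ us → disjoint (s , (tt , us) , tt))

top-seed : ∀ {Γ} → SeqSeed (Γ ▸ ⊤ₗ) ⟦ top {Γ} ⟧
top-seed U disjoint (s , _ , ())

bot-seed : ∀ {Γ} (π : ⊢ Γ) → SeqSeed Γ ⟦ π ⟧ → SeqSeed (Γ ▸ ⊥ₗ) ⟦ bot π ⟧
bot-seed {Γ} π seed (U , u) disjoint (s , (c , ¬¬¬¬u) , rs) =
  seed U disjoint′ (proj₁ (unsnoc Γ ⊥ₗ s) , c , rs)
  where
  disjoint′ : ¬ (Box Γ U ≬ ⟦ π ⟧)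
  disjoint′ (g , b , rg) =
    ¬¬¬¬u λ ¬¬u → ¬¬u λ us →
      disjoint (snoc Γ ⊥ₗ g tt , Pointwise-snoc⁺ _ Γ ⊥ₗ {U} {u} b us ,
                unsnoc-snoc⁺ Γ ⊥ₗ {⟦ π ⟧ ∘ proj₁} rg)

par-seed : ∀ {Γ A B} (π : ⊢ Γ ▸ A ▸ B) → SeqSeed (Γ ▸ A ▸ B) ⟦ π ⟧ → SeqSeed (Γ ▸ A ⅋ B) ⟦ par π ⟧
par-seed {Γ} {A} {B} π seed (U , u) disjoint (s , (c , d) , rs) =
  d λ (w₁ , w₂ , w₁×w₂⊆u , p , q) →
    seed ((U , w₁) , w₂) (disjoint′ w₁ w₂ w₁×w₂⊆u)
      (_ , (Pointwise-snoc⁺ _ Γ A {U} {w₁} c p , q) , rs)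
  where
  disjoint′ : ∀ w₁ w₂ → (∀ a b → T (w₁ a) → T (w₂ b) → ¬ ¬ T (u (a , b))) →
              ¬ (Box (Γ ▸ A ▸ B) ((U , w₁) , w₂) ≬ ⟦ π ⟧)
  disjoint′ w₁ w₂ w₁×w₂⊆u = Pointwise-snoc-¬≬ _ (Γ ▸ A) B {U , w₁} {w₂} λ x b bx wb rt →
    Pointwise-snoc-¬≬ _ Γ A {U} {w₁} {λ x → ⟦ π ⟧ (x , b)}
      (λ g a bg wa rt → w₁×w₂⊆u a b wa wb λ uab →
         disjoint (snoc Γ (A ⅋ B) g (a , b) , Pointwise-snoc⁺ _ Γ (A ⅋ B) {U} {u} bg uab ,
                   unsnoc-snoc⁺ Γ (A ⅋ B) {λ (g , a , b) → ⟦ π ⟧ (snoc Γ A g a , b)} rt))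
      (x , bx , rt)


seed-along-last :
  ∀ {Γ A C} (ι : ∣ A ∣f → ∣ C ∣f) →
  (∀ u a → P ((C *) ^⊥ᵢ) u (ι a) → P ((A *) ^⊥ᵢ) (u ∘ ι) a) →
  {r : Pred ∣ Γ ▸ A ∣s} {r′ : Pred ∣ Γ ▸ C ∣s} →
  (∀ g a → r′ (snoc Γ C g (ι a)) ≡ r (snoc Γ A g a)) →
  SeqSeed (Γ ▸ A) r → ∀ U u → ¬ (Box (Γ ▸ C) (U , u) ≬ r′) →
  ∀ g a → DualBox Γ U g → P ((C *) ^⊥ᵢ) (T ∘ u) (ι a) → ¬ r′ (snoc Γ C g (ι a))
seed-along-last {Γ} {A} {C} ι dual-ι {r} r′∘ι≡r seed U u disjoint g a dg dιa r′ιa =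
  seed (U , u ∘ ι) disjoint′
    (snoc Γ A g a , Pointwise-snoc⁺ _ Γ A {U} {u ∘ ι} dg (dual-ι (T ∘ u) a dιa) ,
     subst id (r′∘ι≡r g a) r′ιa)
  where
  disjoint′ : ¬ (Box (Γ ▸ A) (U , u ∘ ι) ≬ r)
  disjoint′ = Pointwise-snoc-¬≬ _ Γ A {U} {u ∘ ι} λ g a bg uιa rt →
    disjoint (snoc Γ C g (ι a) , Pointwise-snoc⁺ _ Γ C {U} {u} bg uιa ,
              subst id (sym (r′∘ι≡r g a)) rt)

⟦with'⟧-inj₁ : ∀ Γ {A B} (π₁ : ⊢ Γ ▸ A) (π₂ : ⊢ Γ ▸ B) g a →
               ⟦ with' π₁ π₂ ⟧ (snoc Γ (A & B) g (inj₁ a)) ≡ ⟦ π₁ ⟧ (snoc Γ A g a)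
⟦with'⟧-inj₁ [] π₁ π₂ g a = refl
⟦with'⟧-inj₁ (Γ ▸ C) π₁ π₂ g a = refl

⟦with'⟧-inj₂ : ∀ Γ {A B} (π₁ : ⊢ Γ ▸ A) (π₂ : ⊢ Γ ▸ B) g b →
               ⟦ with' π₁ π₂ ⟧ (snoc Γ (A & B) g (inj₂ b)) ≡ ⟦ π₂ ⟧ (snoc Γ B g b)
⟦with'⟧-inj₂ [] π₁ π₂ g b = refl
⟦with'⟧-inj₂ (Γ ▸ C) π₁ π₂ g b = refl

⟦plus₁⟧-inj₁ : ∀ Γ {A B} (π : ⊢ Γ ▸ A) g a →
               ⟦ plus₁ {B = B} π ⟧ (snoc Γ (A ⊕ B) g (inj₁ a)) ≡ ⟦ π ⟧ (snoc Γ A g a)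
⟦plus₁⟧-inj₁ [] π g a = refl
⟦plus₁⟧-inj₁ (Γ ▸ C) π g a = refl

⟦plus₁⟧-inj₂ : ∀ Γ {A B} (π : ⊢ Γ ▸ A) g b → ⟦ plus₁ {B = B} π ⟧ (snoc Γ (A ⊕ B) g (inj₂ b)) ≡ Empty
⟦plus₁⟧-inj₂ [] π g b = refl
⟦plus₁⟧-inj₂ (Γ ▸ C) π g b = refl

⟦plus₂⟧-inj₁ : ∀ Γ {A B} (π : ⊢ Γ ▸ B) g a → ⟦ plus₂ {A = A} π ⟧ (snoc Γ (A ⊕ B) g (inj₁ a)) ≡ Empty
⟦plus₂⟧-inj₁ [] π g a = refl
⟦plus₂⟧-inj₁ (Γ ▸ C) π g a = refl

⟦plus₂⟧-inj₂ : ∀ Γ {A B} (π : ⊢ Γ ▸ B) g b →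
               ⟦ plus₂ {A = A} π ⟧ (snoc Γ (A ⊕ B) g (inj₂ b)) ≡ ⟦ π ⟧ (snoc Γ B g b)
⟦plus₂⟧-inj₂ [] π g b = refl
⟦plus₂⟧-inj₂ (Γ ▸ C) π g b = refl

with-seed : ∀ {Γ A B} (π₁ : ⊢ Γ ▸ A) (π₂ : ⊢ Γ ▸ B) →
            SeqSeed (Γ ▸ A) ⟦ π₁ ⟧ → SeqSeed (Γ ▸ B) ⟦ π₂ ⟧ → SeqSeed (Γ ▸ A & B) ⟦ with' π₁ π₂ ⟧
with-seed {Γ} {A} {B} π₁ π₂ seed₁ seed₂ (U , u) disjoint =
  Pointwise-snoc-¬≬ _ Γ (A & B) {U} {u} λ where
    g (inj₁ a) → seed-along-last inj₁ (λ _ _ → id) (⟦with'⟧-inj₁ Γ π₁ π₂) seed₁ U u disjoint g a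
    g (inj₂ b) → seed-along-last inj₂ (λ _ _ → id) (⟦with'⟧-inj₂ Γ π₁ π₂) seed₂ U u disjoint g b

plus₁-seed : ∀ {Γ A B} (π : ⊢ Γ ▸ A) → SeqSeed (Γ ▸ A) ⟦ π ⟧ → SeqSeed (Γ ▸ A ⊕ B) ⟦ plus₁ π ⟧
plus₁-seed {Γ} {A} {B} π seed (U , u) disjoint = Pointwise-snoc-¬≬ _ Γ (A ⊕ B) {U} {u} λ where
  g (inj₁ a) →
    seed-along-last inj₁ (λ u → ⊕-dual-inj₁ (A *) (B *) {u}) (⟦plus₁⟧-inj₁ Γ π) seed
      U u disjoint g a
  g (inj₂ b) _ _ → subst id (⟦plus₁⟧-inj₂ Γ π g b)

plus₂-seed : ∀ {Γ A B} (π : ⊢ Γ ▸ B) → SeqSeed (Γ ▸ B) ⟦ π ⟧ → SeqSeed (Γ ▸ A ⊕ B) ⟦ plus₂ π ⟧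
plus₂-seed {Γ} {A} {B} π seed (U , u) disjoint = Pointwise-snoc-¬≬ _ Γ (A ⊕ B) {U} {u} λ where
  g (inj₁ a) _ _ → subst id (⟦plus₂⟧-inj₁ Γ π g a)
  g (inj₂ b) →
    seed-along-last inj₂ (λ u → ⊕-dual-inj₂ (A *) (B *) {u}) (⟦plus₂⟧-inj₂ Γ π) seed
      U u disjoint g b

⟦cut⟧-join : ∀ {Γ Δ A} (π₁ : ⊢ Γ ▸ A) (π₂ : ⊢ Δ ▸ A ᗮ) {g d} a →
             ⟦ π₁ ⟧ (snoc Γ A g a) → ⟦ π₂ ⟧ (snoc Δ (A ᗮ) d (castᗮ A a)) →
             ⟦ cut π₁ π₂ ⟧ (join Γ Δ g d)
⟦cut⟧-join {Γ} {Δ} {A} π₁ π₂ {g} {d} a r₁ r₂ =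
  subst (λ gd → Σ ∣ A ∣f λ a → ⟦ π₁ ⟧ (snoc Γ A (proj₁ gd) a) ×
                              ⟦ π₂ ⟧ (snoc Δ (A ᗮ) (proj₂ gd) (castᗮ A a)))
        (sym (split-join Γ Δ g d)) (a , r₁ , r₂)

⟦tens⟧-snoc-join : ∀ {Γ Δ A B} (π₁ : ⊢ Γ ▸ A) (π₂ : ⊢ Δ ▸ B) {g d a b} →
                   ⟦ π₁ ⟧ (snoc Γ A g a) → ⟦ π₂ ⟧ (snoc Δ B d b) →
                   ⟦ tens π₁ π₂ ⟧ (snoc (Γ ++ Δ) (A ⊗ B) (join Γ Δ g d) (a , b))
⟦tens⟧-snoc-join {Γ} {Δ} {A} {B} π₁ π₂ {g} {d} {a} {b} r₁ r₂ =
  unsnoc-snoc⁺ (Γ ++ Δ) (A ⊗ B) {λ (gd , a , b) → ⟦ π₁ ⟧ (snoc Γ A (proj₁ (split Γ Δ gd)) a) ×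
                                                 ⟦ π₂ ⟧ (snoc Δ B (proj₂ (split Γ Δ gd)) b)}
    (subst (λ gd → ⟦ π₁ ⟧ (snoc Γ A (proj₁ gd) a) × ⟦ π₂ ⟧ (snoc Δ B (proj₂ gd) b))
           (sym (split-join Γ Δ g d)) (r₁ , r₂))

cut-seed : ∀ {Γ Δ A} (π₁ : ⊢ Γ ▸ A) (π₂ : ⊢ Δ ▸ A ᗮ) →
           SeqSeed (Γ ▸ A) ⟦ π₁ ⟧ → SeqSeed (Δ ▸ A ᗮ) ⟦ π₂ ⟧ → SeqSeed (Γ ++ Δ) ⟦ cut π₁ π₂ ⟧
cut-seed {Γ} {Δ} {A} π₁ π₂ seed₁ seed₂ W disjoint (s , dual , a , r₁ , r₂)
  with Pointwise-split _ Γ Δ dual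
... | dg , dd =
  ᗮ*⊆*^⊥ A a (shadow-P ⟦ π₂ ⟧? W₂ seed₂ dd r₂) (mono (A *) x⊆¬y a (shadow-P ⟦ π₁ ⟧? W₁ seed₁ dg r₁))
  where
  W₁ : Family Γ
  W₁ = proj₁ (splitᶠ Γ Δ W)
  W₂ : Family Δ
  W₂ = proj₂ (splitᶠ Γ Δ W)
  x⊆¬y : Shadow ⟦ π₁ ⟧? W₁ ⊆ λ a → ¬ Shadow ⟦ π₂ ⟧? W₂ (castᗮ A a)
  x⊆¬y a (g , bg , r₁) (d , bd , r₂) =
    disjoint (join Γ Δ g d , Pointwise-join _ Γ Δ {W} bg bd , ⟦cut⟧-join π₁ π₂ a r₁ r₂)

tens-seed : ∀ {Γ Δ A B} (π₁ : ⊢ Γ ▸ A) (π₂ : ⊢ Δ ▸ B) →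
            SeqSeed (Γ ▸ A) ⟦ π₁ ⟧ → SeqSeed (Δ ▸ B) ⟦ π₂ ⟧ →
            SeqSeed ((Γ ++ Δ) ▸ A ⊗ B) ⟦ tens π₁ π₂ ⟧
tens-seed {Γ} {Δ} {A} {B} π₁ π₂ seed₁ seed₂ (W , w) disjoint (s , (dual , dab) , r₁ , r₂)
  with Pointwise-split _ Γ Δ dual
... | dg , dd =
  dab (x , y , x×y⊆¬w ,
       mono (A *) (λ _ → fromWitness) _ (shadow-P ⟦ π₁ ⟧? W₁ seed₁ dg r₁) ,
       mono (B *) (λ _ → fromWitness) _ (shadow-P ⟦ π₂ ⟧? W₂ seed₂ dd r₂))
  where
  W₁ : Family Γ
  W₁ = proj₁ (splitᶠ Γ Δ W)
  W₂ : Family Δ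
  W₂ = proj₂ (splitᶠ Γ Δ W)
  x : ∣ A ∣f → Bool
  x = isYes ∘ Shadow? ⟦ π₁ ⟧? W₁
  y : ∣ B ∣f → Bool
  y = isYes ∘ Shadow? ⟦ π₂ ⟧? W₂
  x×y⊆¬w : ∀ a b → T (x a) → T (y b) → ¬ T (w (a , b))
  x×y⊆¬w a b xa yb wab with toWitness xa | toWitness yb
  ... | g , bg , r₁ | d , bd , r₂ =
    disjoint (snoc (Γ ++ Δ) (A ⊗ B) (join Γ Δ g d) (a , b) ,
              Pointwise-snoc⁺ _ (Γ ++ Δ) (A ⊗ B) {W} {w} (Pointwise-join _ Γ Δ {W} bg bd) wab ,
              ⟦tens⟧-snoc-join π₁ π₂ r₁ r₂)

swap₂ : ∀ Γ A B → ∣ Γ ▸ A ▸ B ∣s → ∣ Γ ▸ B ▸ A ∣s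
swap₂ Γ A B (x , b) = snoc Γ B (proj₁ (unsnoc Γ A x)) b , proj₂ (unsnoc Γ A x)

swap₂-involutive : ∀ Γ A B t → swap₂ Γ B A (swap₂ Γ A B t) ≡ t
swap₂-involutive [] A B t = refl
swap₂-involutive (Γ ▸ C) A B t = refl

swap₂ᶠ : ∀ Γ A B → Family (Γ ▸ A ▸ B) → Family (Γ ▸ B ▸ A)
swap₂ᶠ Γ A B ((U , u) , v) = (U , v) , u

Pointwise-swap₂ : ∀ R Γ A B {U t} → Pointwise R (Γ ▸ A ▸ B) U t →
                  Pointwise R (Γ ▸ B ▸ A) (swap₂ᶠ Γ A B U) (swap₂ Γ A B t)
Pointwise-swap₂ R Γ A B ((p , q) , q′) = Pointwise-snoc⁺ R Γ B p q′ , q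

exchange : ∀ Γ A B Δ → ∣ (Γ ▸ A ▸ B) ++ Δ ∣s → ∣ (Γ ▸ B ▸ A) ++ Δ ∣s
exchange Γ A B Δ s =
  join (Γ ▸ B ▸ A) Δ (swap₂ Γ A B (proj₁ (split (Γ ▸ A ▸ B) Δ s))) (proj₂ (split (Γ ▸ A ▸ B) Δ s))

exchangeᶠ : ∀ Γ A B Δ → Family ((Γ ▸ A ▸ B) ++ Δ) → Family ((Γ ▸ B ▸ A) ++ Δ)
exchangeᶠ Γ A B Δ W =
  joinᶠ (Γ ▸ B ▸ A) Δ (swap₂ᶠ Γ A B (proj₁ (splitᶠ (Γ ▸ A ▸ B) Δ W)))
                      (proj₂ (splitᶠ (Γ ▸ A ▸ B) Δ W))

exchange-involutive : ∀ Γ A B Δ s → exchange Γ B A Δ (exchange Γ A B Δ s) ≡ s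
exchange-involutive Γ A B Δ s
  rewrite split-join (Γ ▸ B ▸ A) Δ (swap₂ Γ A B (proj₁ (split (Γ ▸ A ▸ B) Δ s)))
                                   (proj₂ (split (Γ ▸ A ▸ B) Δ s))
        | swap₂-involutive Γ A B (proj₁ (split (Γ ▸ A ▸ B) Δ s))
        = join-split (Γ ▸ A ▸ B) Δ s

splitᶠ-exchangeᶠ : ∀ Γ A B Δ W →
                   splitᶠ (Γ ▸ B ▸ A) Δ (exchangeᶠ Γ A B Δ W) ≡
                   (swap₂ᶠ Γ A B (proj₁ (splitᶠ (Γ ▸ A ▸ B) Δ W)) , proj₂ (splitᶠ (Γ ▸ A ▸ B) Δ W))
splitᶠ-exchangeᶠ Γ A B Δ W = splitᶠ-joinᶠ (Γ ▸ B ▸ A) Δ _ _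

module _ (R : FormulaRel) (Γ : Seq) (A B : Formula) (Δ : Seq) where

  Pointwise-exchange : ∀ {W s} → Pointwise R ((Γ ▸ A ▸ B) ++ Δ) W s →
                       Pointwise R ((Γ ▸ B ▸ A) ++ Δ) (exchangeᶠ Γ A B Δ W) (exchange Γ A B Δ s)
  Pointwise-exchange {W} p with Pointwise-split R (Γ ▸ A ▸ B) Δ p
  ... | p₁ , p₂ =
    Pointwise-join R (Γ ▸ B ▸ A) Δ {exchangeᶠ Γ A B Δ W}
      (subst (λ V → Pointwise R (Γ ▸ B ▸ A) (proj₁ V) _) (sym (splitᶠ-exchangeᶠ Γ A B Δ W))
             (Pointwise-swap₂ R Γ A B p₁))
      (subst (λ V → Pointwise R Δ (proj₂ V) _) (sym (splitᶠ-exchangeᶠ Γ A B Δ W)) p₂)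

  Pointwise-exchange⁻ : ∀ {W t} → Pointwise R ((Γ ▸ B ▸ A) ++ Δ) (exchangeᶠ Γ A B Δ W) t →
                        Pointwise R ((Γ ▸ A ▸ B) ++ Δ) W (exchange Γ B A Δ t)
  Pointwise-exchange⁻ {W} p with Pointwise-split R (Γ ▸ B ▸ A) Δ p
  ... | p₁ , p₂ =
    Pointwise-join R (Γ ▸ A ▸ B) Δ {W}
      (Pointwise-swap₂ R Γ B A
        (subst (λ V → Pointwise R (Γ ▸ B ▸ A) (proj₁ V) _) (splitᶠ-exchangeᶠ Γ A B Δ W) p₁))
      (subst (λ V → Pointwise R Δ (proj₂ V) _) (splitᶠ-exchangeᶠ Γ A B Δ W) p₂)

exch-seed : ∀ {Γ A B} Δ (π : ⊢ (Γ ▸ A ▸ B) ++ Δ) → SeqSeed ((Γ ▸ A ▸ B) ++ Δ) ⟦ π ⟧ →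
            SeqSeed ((Γ ▸ B ▸ A) ++ Δ) ⟦ exch Δ π ⟧
exch-seed {Γ} {A} {B} Δ π seed W disjoint (s , dual , rs) =
  seed (exchangeᶠ Γ B A Δ W) disjoint′ (exchange Γ B A Δ s , Pointwise-exchange _ Γ B A Δ dual , rs)
  where
  disjoint′ : ¬ (Box ((Γ ▸ A ▸ B) ++ Δ) (exchangeᶠ Γ B A Δ W) ≬ ⟦ π ⟧)
  disjoint′ (t , bt , rt) =
    disjoint (exchange Γ A B Δ t , Pointwise-exchange⁻ _ Γ B A Δ bt ,
              subst ⟦ π ⟧ (sym (exchange-involutive Γ A B Δ t)) rt)

⟦⟧-seed : ∀ {Γ} (π : ⊢ Γ) → SeqSeed Γ ⟦ π ⟧
⟦⟧-seed one = one-seed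
⟦⟧-seed top = top-seed
⟦⟧-seed (bot π) = bot-seed π (⟦⟧-seed π)
⟦⟧-seed (par π) = par-seed π (⟦⟧-seed π)
⟦⟧-seed (tens π₁ π₂) = tens-seed π₁ π₂ (⟦⟧-seed π₁) (⟦⟧-seed π₂)
⟦⟧-seed (plus₁ π) = plus₁-seed π (⟦⟧-seed π)
⟦⟧-seed (plus₂ π) = plus₂-seed π (⟦⟧-seed π)
⟦⟧-seed (with' π₁ π₂) = with-seed π₁ π₂ (⟦⟧-seed π₁) (⟦⟧-seed π₂)
⟦⟧-seed (cut π₁ π₂) = cut-seed π₁ π₂ (⟦⟧-seed π₁) (⟦⟧-seed π₂)
⟦⟧-seed (exch Δ π) = exch-seed Δ π (⟦⟧-seed π)

SeqSeed⇒Seed : ∀ F {r} → Decidable r → SeqSeed ([] ▸ F) r → Seed (F *) r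
SeqSeed⇒Seed F {r} r? seed a ra =
  mono (F *) (complement-in r?) a
    (decidable-stable (P? (decidable-* F) (¬? ∘ T? ∘ complement r?) a) λ ¬p →
       seed (tt , complement r?) disjoint (a , (tt , ¬p) , ra))
  where
  disjoint : ¬ (Box ([] ▸ F) (tt , complement r?) ≬ r)
  disjoint (a , (tt , ∉r) , ra) = complement-out r? a ∉r ra

proposition1 : (F : Formula) (π : ⊢ [] ▸ F) → Seed (F *) ⟦ π ⟧
proposition1 F π = SeqSeed⇒Seed F ⟦ π ⟧? (⟦⟧-seed π)
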